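{- Let $u\ge 3$ be an odd integer. If there exists a $\left(2u,\ \tfrac12(2u-\sqrt{6u-2}),\ \tfrac12(u+1-\sqrt{6u-2})\right)$ cyclic difference set, then $u=2B_i^2+1$ for some integer $i\ge1$, where the integers $A_i,B_i$ are defined by $(2+\sqrt3)^i=A_i+\sqrt3\,B_i$.
   Context: An $(n,k,\lambda)$ cyclic difference set is a $k$-subset $D$ of a cyclic group $G$ of order $n$ such that every non-identity element $g\in G$ has exactly $\lambda$ representations $g=xy^{ -1}$ with $x,y\in D$. -}

module Defs where

open import Data.Nat using (ℕ; zero; suc; _+_; _*_; _∸_; _≟_)
open import Data.Nat.DivMod using (_%_)
open import Data.Fin using (Fin; toℕ)
open import Data.Product using (_×_; _,_; proj₁; proj₂)
open import Data.List using (List; length; filter; cartesianProduct)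
open import Data.List.Relation.Unary.Unique.Propositional using (Unique)
open import Relation.Binary.PropositionalEquality using (_≡_; _≢_)

-- The cyclic group of order n is modelled as ℤ/nℤ with carrier Fin n.
-- diff n x y = toℕ (x - y mod n), i.e. the group element x y⁻¹ written additively.
diff : (n : ℕ) → Fin n → Fin n → ℕ
diff (suc m) x y = (toℕ x + (suc m ∸ toℕ y)) % suc m

reps : (n : ℕ) → List (Fin n) → Fin n → ℕ
reps n D g =
  length (filter (λ p → diff n (proj₁ p) (proj₂ p) ≟ toℕ g) (cartesianProduct D D))

-- D (a duplicate-free list, i.e. a finite subset of ℤ/nℤ) is an
-- (n, k, λ) cyclic difference set
IsCyclicDifferenceSet : (n k lam : ℕ) → List (Fin n) → Set
IsCyclicDifferenceSet n k lam D =
  Unique D × length D ≡ k × ((g : Fin n) → toℕ g ≢ 0 → reps n D g ≡ lam)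

-- (2 + √3)^i = A i + √3 · B i ; AB i = (A i , B i), computed by multiplying by (2 + √3)
AB : ℕ → ℕ × ℕ
AB zero = 1 , 0
AB (suc i) with AB i
... | a , b = 2 * a + 3 * b , a + 2 * b

A B : ℕ → ℕ
A i = proj₁ (AB i)
B i = proj₂ (AB i)

module Submission where

-- Let D be a (2u, k, λ) cyclic difference set in ℤ/2uℤ and let
-- a, b be the numbers of even and odd elements of D, so k = a + b.  Since 2u is
-- even, x - y is odd exactly when x and y have different parity; counting the
-- ordered pairs of D with odd difference in two ways (each of the u odd
-- residues occurs λ times) gives 2ab = uλ.  Hence k² = (a - b)² + 2uλ, i.e.
-- k² = d² + 2uλ for some d.  Writing s = 2(t + 1), the parameter relations
-- become linear in λ and t, and they force λ + t = d², u = 2d² + 1 and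
-- (t + 1)² = 3d² + 1.  Finally every solution of the Pell equation
-- x² = 3y² + 1 is (A i , B i) for some i, by descent along (2 + √3)⁻¹; as
-- u ≥ 3 we have d ≠ 0 and therefore i ≥ 1.

open import Defs
open import Data.Nat
  using (ℕ; zero; suc; _+_; _*_; _∸_; _^_; _≤_; _<_; _≡ᵇ_; _≟_; s≤s; z≤n; z<s; NonZero; parity)
open import Data.Nat.Properties
open import Data.Nat.Divisibility using (_∤_)
open import Data.Nat.DivMod using (_%_; _/_; m≡m%n+[m/n]*n; m%n<n)
open import Data.Nat.Induction using (<-rec)
open import Data.Nat.Tactic.RingSolver using (solve-∀)
open import Data.Parity.Base as ℙ using (Parity; 0ℙ; 1ℙ; _⁻¹)
import Data.Parity.Properties as ℙ
open import Data.Bool using (true; false; if_then_else_)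
open import Data.List
  using (List; []; _∷_; length; filter; cartesianProduct; map; _++_; applyUpTo)
open import Data.List.Properties using (length-applyUpTo)
open import Data.List.Relation.Unary.All using (All; []; _∷_; universal)
open import Data.List.Relation.Unary.All.Properties using (applyUpTo⁺₁)
open import Data.Fin using (Fin; toℕ; fromℕ<)
open import Data.Fin.Properties using (toℕ-fromℕ<; toℕ<n)
open import Data.Product using (_×_; _,_; proj₁; proj₂; ∃-syntax)
open import Data.Sum using (inj₁; inj₂)
open import Relation.Binary.PropositionalEquality
  using (_≡_; _≢_; refl; sym; trans; cong; cong₂; subst; subst₂; module ≡-Reasoning)
open import Relation.Nullary using (contradiction)

open ≡-Reasoning

-- Finite sums over lists

∑ : {A : Set} → List A → (A → ℕ) → ℕ
∑ []       f = 0
∑ (x ∷ xs) f = f x + ∑ xs f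

∑-congᴬ : {A : Set} {f g : A → ℕ} (L : List A) → All (λ x → f x ≡ g x) L → ∑ L f ≡ ∑ L g
∑-congᴬ []      []       = refl
∑-congᴬ (x ∷ L) (e ∷ es) = cong₂ _+_ e (∑-congᴬ L es)

∑-cong : {A : Set} {f g : A → ℕ} (L : List A) → (∀ x → f x ≡ g x) → ∑ L f ≡ ∑ L g
∑-cong L e = ∑-congᴬ L (universal e L)

∑-const : {A : Set} (L : List A) (c : ℕ) → ∑ L (λ _ → c) ≡ length L * c
∑-const []      c = refl
∑-const (x ∷ L) c = cong (c +_) (∑-const L c)

∑-zero : {A : Set} (L : List A) → ∑ L (λ _ → 0) ≡ 0
∑-zero L = trans (∑-const L 0) (*-zeroʳ (length L))

∑-+ : {A : Set} (L : List A) (f g : A → ℕ) → ∑ L (λ x → f x + g x) ≡ ∑ L f + ∑ L g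
∑-+ []      f g = refl
∑-+ (x ∷ L) f g = begin
  f x + g x + ∑ L (λ x → f x + g x) ≡⟨ cong (f x + g x +_) (∑-+ L f g) ⟩
  f x + g x + (∑ L f + ∑ L g)       ≡⟨ +-exchange (f x) (g x) (∑ L f) (∑ L g) ⟩
  f x + ∑ L f + (g x + ∑ L g)       ∎
  where
  +-exchange : ∀ a b c d → a + b + (c + d) ≡ a + c + (b + d)
  +-exchange = solve-∀

∑-*ˡ : {A : Set} (L : List A) (c : ℕ) (f : A → ℕ) → ∑ L (λ x → c * f x) ≡ c * ∑ L f
∑-*ˡ []      c f = sym (*-zeroʳ c)
∑-*ˡ (x ∷ L) c f = trans (cong (c * f x +_) (∑-*ˡ L c f)) (sym (*-distribˡ-+ c (f x) (∑ L f)))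

∑-*ʳ : {A : Set} (L : List A) (c : ℕ) (f : A → ℕ) → ∑ L (λ x → f x * c) ≡ ∑ L f * c
∑-*ʳ L c f = begin
  ∑ L (λ x → f x * c) ≡⟨ ∑-cong L (λ x → *-comm (f x) c) ⟩
  ∑ L (λ x → c * f x) ≡⟨ ∑-*ˡ L c f ⟩
  c * ∑ L f           ≡⟨ *-comm c (∑ L f) ⟩
  ∑ L f * c           ∎

∑-++ : {A : Set} (L M : List A) (f : A → ℕ) → ∑ (L ++ M) f ≡ ∑ L f + ∑ M f
∑-++ []      M f = refl
∑-++ (x ∷ L) M f = trans (cong (f x +_) (∑-++ L M f)) (sym (+-assoc (f x) (∑ L f) (∑ M f)))

∑-map : {A B : Set} (g : A → B) (L : List A) (f : B → ℕ) → ∑ (map g L) f ≡ ∑ L (λ x → f (g x))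
∑-map g []      f = refl
∑-map g (x ∷ L) f = cong (f (g x) +_) (∑-map g L f)

∑-cartesianProduct : {A B : Set} (L : List A) (M : List B) (f : A × B → ℕ) →
  ∑ (cartesianProduct L M) f ≡ ∑ L (λ x → ∑ M (λ y → f (x , y)))
∑-cartesianProduct []      M f = refl
∑-cartesianProduct (x ∷ L) M f =
  trans (∑-++ (map (x ,_) M) _ f) (cong₂ _+_ (∑-map (x ,_) M f) (∑-cartesianProduct L M f))

∑-swap : {A B : Set} (L : List A) (M : List B) (f : A → B → ℕ) →
  ∑ L (λ x → ∑ M (f x)) ≡ ∑ M (λ y → ∑ L (λ x → f x y))
∑-swap []      M f = sym (∑-zero M)
∑-swap (x ∷ L) M f =
  trans (cong (∑ M (f x) +_) (∑-swap L M f)) (sym (∑-+ M (f x) (λ y → ∑ L (λ x → f x y))))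

∑-applyUpTo-∘ : (g f : ℕ → ℕ) (n : ℕ) (h : ℕ → ℕ) →
  ∑ (applyUpTo (λ j → g (f j)) n) h ≡ ∑ (applyUpTo f n) (λ c → h (g c))
∑-applyUpTo-∘ g f zero    h = refl
∑-applyUpTo-∘ g f (suc n) h = cong (h (g (f 0)) +_) (∑-applyUpTo-∘ g (λ j → f (suc j)) n h)

δ : ℕ → ℕ → ℕ
δ m c = if m ≡ᵇ c then 1 else 0

length-filter-≟ : {A : Set} (f : A → ℕ) (c : ℕ) (L : List A) →
  length (filter (λ x → f x ≟ c) L) ≡ ∑ L (λ x → δ (f x) c)
length-filter-≟ f c []      = refl
length-filter-≟ f c (x ∷ L) with f x ≡ᵇ c
... | true  = cong suc (length-filter-≟ f c L)
... | false = length-filter-≟ f c L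

-- Parity of residues modulo an even number

bit : Parity → ℕ
bit 0ℙ = 0
bit 1ℙ = 1

bit-+ : ∀ p q → bit (p ℙ.+ q) ≡ bit (p ⁻¹) * bit q + bit p * bit (q ⁻¹)
bit-+ 0ℙ 0ℙ = refl
bit-+ 0ℙ 1ℙ = refl
bit-+ 1ℙ 0ℙ = refl
bit-+ 1ℙ 1ℙ = refl

bit-partition : ∀ p → bit (p ⁻¹) + bit p ≡ 1
bit-partition 0ℙ = refl
bit-partition 1ℙ = refl

parity-% : ∀ m n .{{_ : NonZero n}} → parity n ≡ 0ℙ → parity (m % n) ≡ parity m
parity-% m n n-even = sym (begin
  parity m                                         ≡⟨ cong parity (m≡m%n+[m/n]*n m n) ⟩
  parity (m % n + m / n * n)                       ≡⟨ ℙ.+-homo-+ (m % n) (m / n * n) ⟩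
  parity (m % n) ℙ.+ parity (m / n * n)            ≡⟨ cong (parity (m % n) ℙ.+_) (ℙ.*-homo-* (m / n) n) ⟩
  parity (m % n) ℙ.+ (parity (m / n) ℙ.* parity n) ≡⟨ cong (λ p → parity (m % n) ℙ.+ (parity (m / n) ℙ.* p)) n-even ⟩
  parity (m % n) ℙ.+ (parity (m / n) ℙ.* 0ℙ)       ≡⟨ cong (parity (m % n) ℙ.+_) (ℙ.*-zeroʳ (parity (m / n))) ⟩
  parity (m % n) ℙ.+ 0ℙ                            ≡⟨ ℙ.+-identityʳ (parity (m % n)) ⟩
  parity (m % n)                                   ∎)

parity-∸ : ∀ {n y} → y ≤ n → parity n ≡ 0ℙ → parity (n ∸ y) ≡ parity y
parity-∸ {n} {y} y≤n n-even = ℙ.+-cancelʳ-≡ (parity y) _ _ (begin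
  parity (n ∸ y) ℙ.+ parity y ≡⟨ ℙ.+-homo-+ (n ∸ y) y ⟨
  parity (n ∸ y + y)          ≡⟨ cong parity (m∸n+n≡m y≤n) ⟩
  parity n                    ≡⟨ n-even ⟩
  0ℙ                          ≡⟨ ℙ.p+p≡0ℙ (parity y) ⟨
  parity y ℙ.+ parity y       ∎)

parityOf : {n : ℕ} → Fin n → Parity
parityOf x = parity (toℕ x)

parity-diff : ∀ {m} (x y : Fin (suc m)) → parity (suc m) ≡ 0ℙ →
  parity (diff (suc m) x y) ≡ parityOf x ℙ.+ parityOf y
parity-diff {m} x y n-even = begin
  parity ((toℕ x + (suc m ∸ toℕ y)) % suc m) ≡⟨ parity-% (toℕ x + (suc m ∸ toℕ y)) (suc m) n-even ⟩
  parity (toℕ x + (suc m ∸ toℕ y))           ≡⟨ ℙ.+-homo-+ (toℕ x) (suc m ∸ toℕ y) ⟩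
  parityOf x ℙ.+ parity (suc m ∸ toℕ y)      ≡⟨ cong (parityOf x ℙ.+_) (parity-∸ (<⇒≤ (toℕ<n y)) n-even) ⟩
  parityOf x ℙ.+ parityOf y                  ∎

-- oddNumber j = 2j + 1, defined so that oddNumber (suc j) = 2 + oddNumber j holds by computation.
oddNumber : ℕ → ℕ
oddNumber zero    = 1
oddNumber (suc j) = suc (suc (oddNumber j))

oddNumber≢0 : ∀ j → oddNumber j ≢ 0
oddNumber≢0 zero    ()
oddNumber≢0 (suc j) ()

oddNumber-< : ∀ {j u} → j < u → oddNumber j < u + u
oddNumber-< {zero}  {suc u} _         = s≤s (subst (1 ≤_) (sym (+-suc u u)) (s≤s z≤n))
oddNumber-< {suc j} {suc u} (s≤s j<u) =
  s≤s (subst (suc (suc (oddNumber j)) ≤_) (sym (+-suc u u)) (s≤s (oddNumber-< j<u)))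

odds : ℕ → List ℕ
odds u = applyUpTo oddNumber u

∑-odds-suc : ∀ u (h : ℕ → ℕ) → ∑ (odds (suc u)) h ≡ h 1 + ∑ (odds u) (λ c → h (suc (suc c)))
∑-odds-suc u h = cong (h 1 +_) (∑-applyUpTo-∘ (λ c → suc (suc c)) oddNumber u h)

δ-odds : ∀ u m → m < u + u → ∑ (odds u) (δ m) ≡ bit (parity m)
δ-odds zero    m ()
δ-odds (suc u) zero          _ = trans (∑-odds-suc u (δ 0)) (∑-zero (odds u))
δ-odds (suc u) (suc zero)    _ = trans (∑-odds-suc u (δ 1)) (cong suc (∑-zero (odds u)))
δ-odds (suc u) (suc (suc m)) m+2<2u+2 =
  trans (∑-odds-suc u (δ (suc (suc m))))
        (δ-odds u m (≤-pred (subst (suc (suc m) ≤_) (+-suc u u) (≤-pred m+2<2u+2))))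

-- Counting ordered pairs with odd difference

#even #odd : {n : ℕ} → List (Fin n) → ℕ
#even D = ∑ D (λ x → bit (parityOf x ⁻¹))
#odd  D = ∑ D (λ x → bit (parityOf x))

length-by-parity : {A : Set} (q : A → Parity) (L : List A) →
  length L ≡ ∑ L (λ x → bit (q x ⁻¹)) + ∑ L (λ x → bit (q x))
length-by-parity q L = begin
  length L                                        ≡⟨ *-identityʳ (length L) ⟨
  length L * 1                                    ≡⟨ ∑-const L 1 ⟨
  ∑ L (λ _ → 1)                                   ≡⟨ ∑-cong L (λ x → bit-partition (q x)) ⟨
  ∑ L (λ x → bit (q x ⁻¹) + bit (q x))            ≡⟨ ∑-+ L (λ x → bit (q x ⁻¹)) (λ x → bit (q x)) ⟩
  ∑ L (λ x → bit (q x ⁻¹)) + ∑ L (λ x → bit (q x)) ∎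

pairs-with-odd-sum : {A : Set} (q : A → Parity) (L : List A) →
  let e = ∑ L (λ x → bit (q x ⁻¹)) ; o = ∑ L (λ x → bit (q x)) in
  ∑ L (λ x → ∑ L (λ y → bit (q x ℙ.+ q y))) ≡ e * o + o * e
pairs-with-odd-sum q L = begin
  ∑ L (λ x → ∑ L (λ y → bit (q x ℙ.+ q y)))
    ≡⟨ ∑-cong L (λ x → ∑-cong L (λ y → bit-+ (q x) (q y))) ⟩
  ∑ L (λ x → ∑ L (λ y → bit (q x ⁻¹) * bit (q y) + bit (q x) * bit (q y ⁻¹)))
    ≡⟨ ∑-cong L (λ x → ∑-+ L (λ y → bit (q x ⁻¹) * bit (q y)) (λ y → bit (q x) * bit (q y ⁻¹))) ⟩
  ∑ L (λ x → ∑ L (λ y → bit (q x ⁻¹) * bit (q y)) + ∑ L (λ y → bit (q x) * bit (q y ⁻¹)))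
    ≡⟨ ∑-cong L (λ x → cong₂ _+_ (∑-*ˡ L (bit (q x ⁻¹)) (λ y → bit (q y)))
                                  (∑-*ˡ L (bit (q x)) (λ y → bit (q y ⁻¹)))) ⟩
  ∑ L (λ x → bit (q x ⁻¹) * o + bit (q x) * e)
    ≡⟨ ∑-+ L (λ x → bit (q x ⁻¹) * o) (λ x → bit (q x) * e) ⟩
  ∑ L (λ x → bit (q x ⁻¹) * o) + ∑ L (λ x → bit (q x) * e)
    ≡⟨ cong₂ _+_ (∑-*ʳ L o (λ x → bit (q x ⁻¹))) (∑-*ʳ L e (λ x → bit (q x))) ⟩
  e * o + o * e ∎
  where
  e o : ℕ
  e = ∑ L (λ x → bit (q x ⁻¹))
  o = ∑ L (λ x → bit (q x))

-- Double counting in ℤ/nℤ for n = 2u: if every non-zero residue has exactly λ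
-- representations as a difference of elements of D, then counting the pairs
-- with odd difference gives  #even·#odd + #odd·#even = uλ.
odd-difference-count : ∀ {m u lam} → suc m ≡ u + u → (D : List (Fin (suc m))) →
  ((g : Fin (suc m)) → toℕ g ≢ 0 → reps (suc m) D g ≡ lam) →
  #even D * #odd D + #odd D * #even D ≡ u * lam
odd-difference-count {m} {u} {lam} n≡u+u D reps≡λ = sym (begin
  u * lam                                          ≡⟨ cong (_* lam) (length-applyUpTo oddNumber u) ⟨
  length (odds u) * lam                            ≡⟨ ∑-const (odds u) lam ⟨
  ∑ (odds u) (λ _ → lam)                           ≡⟨ ∑-congᴬ (odds u) (applyUpTo⁺₁ oddNumber u (λ j<u → sym (count-odd j<u))) ⟩
  ∑ (odds u) count                                 ≡⟨ ∑-cong (odds u) (λ c → length-filter-≟ F c L) ⟩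
  ∑ (odds u) (λ c → ∑ L (λ p → δ (F p) c))         ≡⟨ ∑-swap L (odds u) (λ p → δ (F p)) ⟨
  ∑ L (λ p → ∑ (odds u) (δ (F p)))                 ≡⟨ ∑-cong L (λ p → δ-odds u (F p) (F<u+u p)) ⟩
  ∑ L (λ p → bit (parity (F p)))                   ≡⟨ ∑-cong L (λ p → cong bit (parity-diff (proj₁ p) (proj₂ p) n-even)) ⟩
  ∑ L (λ p → bit (parityOf (proj₁ p) ℙ.+ parityOf (proj₂ p)))
                                                   ≡⟨ ∑-cartesianProduct D D (λ p → bit (parityOf (proj₁ p) ℙ.+ parityOf (proj₂ p))) ⟩
  ∑ D (λ x → ∑ D (λ y → bit (parityOf x ℙ.+ parityOf y)))
                                                   ≡⟨ pairs-with-odd-sum parityOf D ⟩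
  #even D * #odd D + #odd D * #even D              ∎)
  where
  L : List (Fin (suc m) × Fin (suc m))
  L = cartesianProduct D D

  F : Fin (suc m) × Fin (suc m) → ℕ
  F p = diff (suc m) (proj₁ p) (proj₂ p)

  count : ℕ → ℕ
  count c = length (filter (λ p → F p ≟ c) L)

  F<u+u : ∀ p → F p < u + u
  F<u+u p = subst (F p <_) n≡u+u (m%n<n (toℕ (proj₁ p) + (suc m ∸ toℕ (proj₂ p))) (suc m))

  n-even : parity (suc m) ≡ 0ℙ
  n-even = trans (cong parity n≡u+u) (trans (ℙ.+-homo-+ u u) (ℙ.p+p≡0ℙ (parity u)))

  count-odd : ∀ {j} → j < u → count (oddNumber j) ≡ lam
  count-odd {j} j<u = subst (λ c → count c ≡ lam) (toℕ-fromℕ< c<n) (reps≡λ g g≢0)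
    where
    c<n : oddNumber j < suc m
    c<n = subst (oddNumber j <_) (sym n≡u+u) (oddNumber-< j<u)
    g : Fin (suc m)
    g = fromℕ< c<n
    g≢0 : toℕ g ≢ 0
    g≢0 g≡0 = oddNumber≢0 j (trans (sym (toℕ-fromℕ< c<n)) g≡0)

-- Arithmetic of the parameters

square-of-sum-≤ : ∀ {a b} → a ≤ b → ∃[ d ] (a + b) * (a + b) ≡ d * d + 2 * (a * b + b * a)
square-of-sum-≤ {a} a≤b with m≤n⇒∃[o]m+o≡n a≤b
... | d , refl = d , identity a d
  where
  identity : ∀ a d → (a + (a + d)) * (a + (a + d)) ≡ d * d + 2 * (a * (a + d) + (a + d) * a)
  identity = solve-∀

-- (a + b)² exceeds 2(ab + ba) by a square, namely (a - b)².
square-of-sum : ∀ a b → ∃[ d ] (a + b) * (a + b) ≡ d * d + 2 * (a * b + b * a)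
square-of-sum a b with ≤-total a b
... | inj₁ a≤b = square-of-sum-≤ a≤b
... | inj₂ b≤a with square-of-sum-≤ b≤a
...   | d , eq = d , (begin
  (a + b) * (a + b)           ≡⟨ cong (λ z → z * z) (+-comm a b) ⟩
  (b + a) * (b + a)           ≡⟨ eq ⟩
  d * d + 2 * (b * a + a * b) ≡⟨ cong (λ z → d * d + 2 * z) (+-comm (b * a) (a * b)) ⟩
  d * d + 2 * (a * b + b * a) ∎)

s-even : ∀ {k s u} → 2 * k + s ≡ 2 * u → s ≡ 2 * (u ∸ k)
s-even {k} {s} {u} 2k+s≡2u = begin
  s                 ≡⟨ m+n∸m≡n (2 * k) s ⟨
  2 * k + s ∸ 2 * k ≡⟨ cong (_∸ 2 * k) 2k+s≡2u ⟩
  2 * u ∸ 2 * k     ≡⟨ *-distribˡ-∸ 2 u k ⟨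
  2 * (u ∸ k)       ∎

-- For u ≥ 1 we have 2 < 6u; so 6u - 2 is positive and (6u - 2) + 2 = 6u.
2<6u : ∀ {u} → 1 ≤ u → 2 < 6 * u
2<6u 1≤u = <-≤-trans (s≤s (s≤s (s≤s z≤n))) (*-monoʳ-≤ 6 1≤u)

-- Writing s = 2(t + 1), the parameter relations s² = 6u - 2, 2k + s = 2u and
-- 2λ + s = u + 1 become u = 2λ + 2t + 1, k = 2λ + t and t² = 3λ + t.
parameters-normal-form : ∀ {u s k lam} → 1 ≤ u →
  s * s ≡ 6 * u ∸ 2 → 2 * k + s ≡ 2 * u → 2 * lam + s ≡ u + 1 →
  ∃[ t ] (u ≡ 2 * lam + 2 * t + 1 × k ≡ 2 * lam + t × t * t ≡ 3 * lam + t)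
parameters-normal-form {u} {s} {k} {lam} 1≤u s²≡6u-2 2k+s≡2u 2λ+s≡u+1
  with u ∸ k | s-even {k} {s} {u} 2k+s≡2u
... | zero  | refl = contradiction s²≡6u-2 (<⇒≢ (m<n⇒0<n∸m (2<6u 1≤u)))
... | suc t | refl = t , U , K , T
  where
  U : u ≡ 2 * lam + 2 * t + 1
  U = +-cancelʳ-≡ 1 u (2 * lam + 2 * t + 1) (begin
    u + 1                     ≡⟨ 2λ+s≡u+1 ⟨
    2 * lam + 2 * suc t       ≡⟨ regroup lam t ⟩
    2 * lam + 2 * t + 1 + 1   ∎)
    where
    regroup : ∀ lam t → 2 * lam + 2 * suc t ≡ 2 * lam + 2 * t + 1 + 1
    regroup = solve-∀

  K : k ≡ 2 * lam + t
  K = +-cancelʳ-≡ (suc t) k (2 * lam + t) (begin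
    k + suc t                 ≡⟨ *-cancelˡ-≡ (k + suc t) u 2 (trans (*-distribˡ-+ 2 k (suc t)) 2k+s≡2u) ⟩
    u                         ≡⟨ U ⟩
    2 * lam + 2 * t + 1       ≡⟨ regroup lam t ⟩
    2 * lam + t + suc t       ∎)
    where
    regroup : ∀ lam t → 2 * lam + 2 * t + 1 ≡ 2 * lam + t + suc t
    regroup = solve-∀

  T : t * t ≡ 3 * lam + t
  T = *-cancelˡ-≡ (t * t) (3 * lam + t) 4 (+-cancelʳ-≡ (8 * t + 6) _ _ (begin
    4 * (t * t) + (8 * t + 6)        ≡⟨ expand-square t ⟩
    2 * suc t * (2 * suc t) + 2      ≡⟨ cong (_+ 2) s²≡6u-2 ⟩
    6 * u ∸ 2 + 2                    ≡⟨ m∸n+n≡m (<⇒≤ (2<6u 1≤u)) ⟩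
    6 * u                            ≡⟨ cong (6 *_) U ⟩
    6 * (2 * lam + 2 * t + 1)        ≡⟨ expand-6u lam t ⟩
    4 * (3 * lam + t) + (8 * t + 6)  ∎))
    where
    expand-square : ∀ t → 4 * (t * t) + (8 * t + 6) ≡ 2 * suc t * (2 * suc t) + 2
    expand-square = solve-∀
    expand-6u : ∀ lam t → 6 * (2 * lam + 2 * t + 1) ≡ 4 * (3 * lam + t) + (8 * t + 6)
    expand-6u = solve-∀

normal-form-square : ∀ {u k lam t d} →
  u ≡ 2 * lam + 2 * t + 1 → k ≡ 2 * lam + t → t * t ≡ 3 * lam + t →
  k * k ≡ d * d + 2 * (u * lam) → lam + t ≡ d * d
normal-form-square {u} {k} {lam} {t} {d} U K T k²≡ = +-cancelʳ-≡ (2 * lam) (lam + t) (d * d) (begin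
  lam + t + 2 * lam       ≡⟨ regroup lam t ⟩
  3 * lam + t             ≡⟨ T ⟨
  t * t                   ≡⟨ t²≡d²+2λ ⟩
  d * d + 2 * lam         ∎)
  where
  regroup : ∀ lam t → lam + t + 2 * lam ≡ 3 * lam + t
  regroup = solve-∀
  expand-k² : ∀ lam t → (2 * lam + t) * (2 * lam + t) ≡ t * t + (4 * (lam * lam) + 4 * (lam * t))
  expand-k² = solve-∀
  expand-2uλ : ∀ lam t d → d * d + 2 * ((2 * lam + 2 * t + 1) * lam) ≡ d * d + 2 * lam + (4 * (lam * lam) + 4 * (lam * t))
  expand-2uλ = solve-∀
  t²≡d²+2λ : t * t ≡ d * d + 2 * lam
  t²≡d²+2λ = +-cancelʳ-≡ (4 * (lam * lam) + 4 * (lam * t)) _ _ (begin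
    t * t + (4 * (lam * lam) + 4 * (lam * t))         ≡⟨ expand-k² lam t ⟨
    (2 * lam + t) * (2 * lam + t)                     ≡⟨ cong (λ z → z * z) K ⟨
    k * k                                             ≡⟨ k²≡ ⟩
    d * d + 2 * (u * lam)                             ≡⟨ cong (λ z → d * d + 2 * (z * lam)) U ⟩
    d * d + 2 * ((2 * lam + 2 * t + 1) * lam)         ≡⟨ expand-2uλ lam t d ⟩
    d * d + 2 * lam + (4 * (lam * lam) + 4 * (lam * t)) ∎)

parameter-arithmetic : ∀ {u s k lam d} → 1 ≤ u →
  s * s ≡ 6 * u ∸ 2 → 2 * k + s ≡ 2 * u → 2 * lam + s ≡ u + 1 →
  k * k ≡ d * d + 2 * (u * lam) →
  u ≡ 2 * (d * d) + 1 × ∃[ r ] r * r ≡ 3 * (d * d) + 1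
parameter-arithmetic {u} {s} {k} {lam} {d} 1≤u s²≡ 2k+s≡ 2λ+s≡ k²≡
  with parameters-normal-form {u} {s} {k} {lam} 1≤u s²≡ 2k+s≡ 2λ+s≡
... | t , U , K , T = u≡2d²+1 , suc t , r²≡3d²+1
  where
  λ+t≡d² : lam + t ≡ d * d
  λ+t≡d² = normal-form-square {u} {k} {lam} {t} {d} U K T k²≡
  regroup-u : ∀ lam t → 2 * lam + 2 * t + 1 ≡ 2 * (lam + t) + 1
  regroup-u = solve-∀
  expand-r² : ∀ t → suc t * suc t ≡ t * t + 2 * t + 1
  expand-r² = solve-∀
  regroup-r² : ∀ lam t → 3 * lam + t + 2 * t + 1 ≡ 3 * (lam + t) + 1
  regroup-r² = solve-∀
  u≡2d²+1 : u ≡ 2 * (d * d) + 1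
  u≡2d²+1 = begin
    u                      ≡⟨ U ⟩
    2 * lam + 2 * t + 1    ≡⟨ regroup-u lam t ⟩
    2 * (lam + t) + 1      ≡⟨ cong (λ z → 2 * z + 1) λ+t≡d² ⟩
    2 * (d * d) + 1        ∎
  r²≡3d²+1 : suc t * suc t ≡ 3 * (d * d) + 1
  r²≡3d²+1 = begin
    suc t * suc t          ≡⟨ expand-r² t ⟩
    t * t + 2 * t + 1      ≡⟨ cong (λ z → z + 2 * t + 1) T ⟩
    3 * lam + t + 2 * t + 1 ≡⟨ regroup-r² lam t ⟩
    3 * (lam + t) + 1      ≡⟨ cong (λ z → 3 * z + 1) λ+t≡d² ⟩
    3 * (d * d) + 1        ∎

-- The Pell equation x² = 3y² + 1

AB-suc : ∀ {i a b} → AB i ≡ (a , b) → AB (suc i) ≡ (2 * a + 3 * b , a + 2 * b)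
AB-suc AB-i rewrite AB-i = refl

square-reflects-≤ : ∀ {m n} → m * m ≤ n * n → m ≤ n
square-reflects-≤ m²≤n² = ≮⇒≥ (λ n<m → <⇒≱ (*-mono-< n<m n<m) m²≤n²)

pell-x-positive : ∀ {x y} → x * x ≡ 3 * (y * y) + 1 → 0 < x
pell-x-positive {zero}  {y} pell = contradiction (trans pell (+-comm (3 * (y * y)) 1)) (λ ())
pell-x-positive {suc x}     _    = z<s

-- For a solution (x, y) we have 3y ≤ 2x, and x ≤ 2y if y ≠ 0; so the
-- conjugate step (2x - 3y, 2y - x) = (x + √3 y)(2 - √3) stays in ℕ.
-- (9y² ≤ 12y² + 4 = 4x².)
pell-3y≤2x : ∀ {x y} → x * x ≡ 3 * (y * y) + 1 → 3 * y ≤ 2 * x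
pell-3y≤2x {x} {y} pell = square-reflects-≤ (subst (3 * y * (3 * y) ≤_) square-gap (m≤m+n _ (3 * (y * y) + 4)))
  where
  double-square : ∀ x → 2 * x * (2 * x) ≡ 4 * (x * x)
  double-square = solve-∀
  expand : ∀ y → 4 * (3 * (y * y) + 1) ≡ 3 * y * (3 * y) + (3 * (y * y) + 4)
  expand = solve-∀
  square-gap : 3 * y * (3 * y) + (3 * (y * y) + 4) ≡ 2 * x * (2 * x)
  square-gap = begin
    3 * y * (3 * y) + (3 * (y * y) + 4) ≡⟨ expand y ⟨
    4 * (3 * (y * y) + 1)               ≡⟨ cong (4 *_) pell ⟨
    4 * (x * x)                         ≡⟨ double-square x ⟨
    2 * x * (2 * x)                     ∎

-- (x² = 3y² + 1 ≤ 4y² when y ≠ 0.)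
pell-x≤2y : ∀ {x y} → x * x ≡ 3 * (y * y) + 1 → 0 < y → x ≤ 2 * y
pell-x≤2y {x} {y} pell 0<y = square-reflects-≤ (subst₂ _≤_ (sym pell) (expand y)
  (+-monoʳ-≤ (3 * (y * y)) (*-mono-≤ 0<y 0<y)))
  where
  expand : ∀ y → 3 * (y * y) + y * y ≡ 2 * y * (2 * y)
  expand = solve-∀

-- The norm x² - 3y² is invariant under multiplication by 2 + √3.
norm-invariant : ∀ a b → a * a + 3 * ((a + 2 * b) * (a + 2 * b)) ≡ (2 * a + 3 * b) * (2 * a + 3 * b) + 3 * (b * b)
norm-invariant = solve-∀

pell-descent : ∀ {x y} → x * x ≡ 3 * (y * y) + 1 → 0 < y →
  ∃[ a ] ∃[ b ] (a * a ≡ 3 * (b * b) + 1 × 2 * a + 3 * b ≡ x × a + 2 * b ≡ y × b < y)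
pell-descent {x} {y} pell 0<y
  with m≤n⇒∃[o]m+o≡n (pell-3y≤2x {x} {y} pell) | m≤n⇒∃[o]m+o≡n (pell-x≤2y {x} {y} pell 0<y)
... | a , 3y+a≡2x | b , x+b≡2y = a , b , a-pell , x≡ , y≡ , b<y
  where
  regroup-x : ∀ a b x y → 2 * a + 3 * b + (6 * y + 3 * x) ≡ 2 * (3 * y + a) + 3 * (x + b)
  regroup-x = solve-∀
  regroup-x' : ∀ x y → 2 * (2 * x) + 3 * (2 * y) ≡ x + (6 * y + 3 * x)
  regroup-x' = solve-∀
  regroup-y : ∀ a b x y → a + 2 * b + (3 * y + 2 * x) ≡ (3 * y + a) + 2 * (x + b)
  regroup-y = solve-∀
  regroup-y' : ∀ x y → 2 * x + 2 * (2 * y) ≡ y + (3 * y + 2 * x)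
  regroup-y' = solve-∀
  regroup-norm : ∀ b y → 3 * (y * y) + 1 + 3 * (b * b) ≡ 3 * (b * b) + 1 + 3 * (y * y)
  regroup-norm = solve-∀

  x≡ : 2 * a + 3 * b ≡ x
  x≡ = +-cancelʳ-≡ (6 * y + 3 * x) _ _ (begin
    2 * a + 3 * b + (6 * y + 3 * x)    ≡⟨ regroup-x a b x y ⟩
    2 * (3 * y + a) + 3 * (x + b)      ≡⟨ cong₂ (λ p q → 2 * p + 3 * q) 3y+a≡2x x+b≡2y ⟩
    2 * (2 * x) + 3 * (2 * y)          ≡⟨ regroup-x' x y ⟩
    x + (6 * y + 3 * x)                ∎)

  y≡ : a + 2 * b ≡ y
  y≡ = +-cancelʳ-≡ (3 * y + 2 * x) _ _ (begin
    a + 2 * b + (3 * y + 2 * x)        ≡⟨ regroup-y a b x y ⟩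
    (3 * y + a) + 2 * (x + b)          ≡⟨ cong₂ (λ p q → p + 2 * q) 3y+a≡2x x+b≡2y ⟩
    2 * x + 2 * (2 * y)                ≡⟨ regroup-y' x y ⟩
    y + (3 * y + 2 * x)                ∎)

  a-pell : a * a ≡ 3 * (b * b) + 1
  a-pell = +-cancelʳ-≡ (3 * (y * y)) _ _ (begin
    a * a + 3 * (y * y)                                ≡⟨ cong (λ z → a * a + 3 * (z * z)) y≡ ⟨
    a * a + 3 * ((a + 2 * b) * (a + 2 * b))            ≡⟨ norm-invariant a b ⟩
    (2 * a + 3 * b) * (2 * a + 3 * b) + 3 * (b * b)    ≡⟨ cong (λ z → z * z + 3 * (b * b)) x≡ ⟩
    x * x + 3 * (b * b)                                ≡⟨ cong (_+ 3 * (b * b)) pell ⟩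
    3 * (y * y) + 1 + 3 * (b * b)                      ≡⟨ regroup-norm b y ⟩
    3 * (b * b) + 1 + 3 * (y * y)                      ∎)

  -- y = a + 2b with a > 0
  b<y : b < y
  b<y = subst (b <_) y≡ (<-≤-trans (m<n+m b (pell-x-positive {a} {b} a-pell)) (+-monoʳ-≤ a (m≤m+n b (b + 0))))

pell-solutions : ∀ y x → x * x ≡ 3 * (y * y) + 1 → ∃[ i ] AB i ≡ (x , y)
pell-solutions = <-rec Solved descend
  where
  Solved : ℕ → Set
  Solved y = ∀ x → x * x ≡ 3 * (y * y) + 1 → ∃[ i ] AB i ≡ (x , y)
  descend : ∀ y → (∀ {b} → b < y → Solved b) → Solved y
  descend zero    _   x pell = 0 , cong (_, 0) (sym (m*n≡1⇒n≡1 x x pell))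
  descend y@(suc _) rec x pell =
    let a , b , a-pell , x≡ , y≡ , b<y = pell-descent {x} {y} pell z<s
        i , AB-i = rec b<y a a-pell
    in  suc i , trans (AB-suc AB-i) (cong₂ _,_ x≡ y≡)

pell-positive-index : ∀ {x y} → x * x ≡ 3 * (y * y) + 1 → 0 < y → ∃[ i ] (1 ≤ i × B i ≡ y)
pell-positive-index {x} {y} pell 0<y with pell-solutions y x pell
... | zero  , AB-0 = contradiction (cong proj₂ AB-0) (<⇒≢ 0<y)
... | suc i , AB-i = suc i , s≤s z≤n , cong proj₂ AB-i

root-positive : ∀ {u d} → 3 ≤ u → u ≡ 2 * (d * d) + 1 → 0 < d
root-positive {d = zero}  3≤u u≡1 = contradiction (subst (3 ≤_) u≡1 3≤u) (λ { (s≤s ()) })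
root-positive {d = suc _} _   _   = z<s

lemma3p5 : (u : ℕ) → 3 ≤ u → 2 ∤ u →
    (s k lam : ℕ) → s * s ≡ 6 * u ∸ 2 → 2 * k + s ≡ 2 * u → 2 * lam + s ≡ u + 1 →
    (D : List (Fin (2 * u))) → IsCyclicDifferenceSet (2 * u) k lam D →
    ∃[ i ] (1 ≤ i × u ≡ 2 * B i ^ 2 + 1)
-- (Matching u = suc _ exposes 2u as a successor, the form in which diff computes.)
lemma3p5 u@(suc _) 3≤u _ s k lam s²≡6u-2 2k+s≡2u 2λ+s≡u+1 D (_ , |D|≡k , reps≡λ) =
  let u≡2d²+1 , r , r²≡3d²+1 = parameter-arithmetic {u} {s} {k} {lam} {d} (≤-trans (s≤s z≤n) 3≤u)
                                  s²≡6u-2 2k+s≡2u 2λ+s≡u+1 k²≡d²+2uλ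
      i , 1≤i , Bi≡d = pell-positive-index {r} {d} r²≡3d²+1 (root-positive 3≤u u≡2d²+1)
  in  i , 1≤i , subst (λ z → u ≡ 2 * z ^ 2 + 1) (sym Bi≡d) (trans u≡2d²+1 (cong (λ z → 2 * z + 1) (square d)))
  where
  a b d : ℕ
  a = #even D
  b = #odd D
  d = proj₁ (square-of-sum a b)

  2u≡u+u : 2 * u ≡ u + u
  2u≡u+u = cong (u +_) (+-identityʳ u)

  k²≡d²+2uλ : k * k ≡ d * d + 2 * (u * lam)
  k²≡d²+2uλ = begin
    k * k                        ≡⟨ cong (λ z → z * z) (trans (sym |D|≡k) (length-by-parity parityOf D)) ⟩
    (a + b) * (a + b)            ≡⟨ proj₂ (square-of-sum a b) ⟩
    d * d + 2 * (a * b + b * a)  ≡⟨ cong (λ z → d * d + 2 * z) (odd-difference-count {u = u} 2u≡u+u D reps≡λ) ⟩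
    d * d + 2 * (u * lam)        ∎

  square : ∀ n → n * n ≡ n ^ 2
  square n = cong (n *_) (sym (*-identityʳ n))
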